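{- Let $\Sigma$ be an alphabet with $s$ characters and let $\sigma \in \Sigma$. For any unary word $\sigma^w$ (the word consisting of $w$ copies of $\sigma$) and any integer $d$ with $w \ge d > 0$, $$|CN(\sigma^w, d)| = \sum_{m=w-d}^{w} \binom{m-1}{d+m-w} (s-1)^{d+m-w}.$$ In particular, if $s = 2$, then $|CN(\sigma^w,d)| = \binom{w}{d}$.
   Context: For words $U,V$ over $\Sigma$, the Levenshtein distance $d_{lev}(U,V)$ is the minimum number of single-character insertions, deletions and substitutions needed to transform $U$ into $V$. The $d$-neighborhood of $W$ is $N(W,d) = \{U \in \Sigma^* : d_{lev}(U,W) \le d\}$. The condensed $d$-neighborhood is $CN(W,d) = N(W,d) \setminus N(W,d)\Sigma^{+}$, i.e. the set of words of $N(W,d)$ that do not have a proper prefix lying in $N(W,d)$. The convention $0^0 = 1$ is used. -}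

module Defs where

open import Data.Nat using (ℕ; zero; suc; _+_; _*_; _∸_; _^_)
open import Data.Nat.ListAction using (sum)
open import Data.Nat.Combinatorics using (_C_)
open import Data.Fin using (Fin)
open import Data.List using (List; []; _∷_; _++_; length; map; upTo)
open import Data.List.Membership.Propositional using (_∈_)
open import Data.List.Relation.Unary.Unique.Propositional using (Unique)
open import Data.Product using (Σ; ∃; _×_)
open import Relation.Binary.PropositionalEquality using (_≡_)
open import Relation.Nullary using (¬_)
open import Function.Bundles using (_⇔_)

Word : ℕ → Set
Word s = List (Fin s)

data OneEdit {s : ℕ} : Word s → Word s → Set where
  ins : (xs ys : Word s) (a : Fin s) → OneEdit (xs ++ ys) (xs ++ a ∷ ys)
  del : (xs ys : Word s) (a : Fin s) → OneEdit (xs ++ a ∷ ys) (xs ++ ys)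
  sub : (xs ys : Word s) (a b : Fin s) → OneEdit (xs ++ a ∷ ys) (xs ++ b ∷ ys)

-- Within k U V : U can be transformed into V using at most k single-character edits,
-- i.e. d_lev(U,V) ≤ k.
data Within {s : ℕ} : ℕ → Word s → Word s → Set where
  done : ∀ {k U} → Within k U U
  step : ∀ {k U V W} → OneEdit U V → Within k V W → Within (suc k) U W

InN : {s : ℕ} → Word s → ℕ → Word s → Set
InN W d U = Within d U W

InNΣ⁺ : {s : ℕ} → Word s → ℕ → Word s → Set
InNΣ⁺ {s} W d U = Σ (Word s) λ P → Σ (Fin s) λ c → Σ (Word s) λ cs →
  (U ≡ P ++ c ∷ cs) × InN W d P

InCN : {s : ℕ} → Word s → ℕ → Word s → Set
InCN W d U = InN W d U × ¬ InNΣ⁺ W d U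

HasCard : {s : ℕ} → (Word s → Set) → ℕ → Set
HasCard {s} P n = Σ (List (Word s)) λ L → Unique L × (∀ U → (U ∈ L) ⇔ P U) × (length L ≡ n)

-- Σ_{m=a}^{b} f m  (for a ≤ b; lists m = a, a+1, …, b)
sumFromTo : ℕ → ℕ → (ℕ → ℕ) → ℕ
sumFromTo a b f = sum (map (λ i → f (a + i)) (upTo (suc (b ∸ a))))

cnFormula : ℕ → ℕ → ℕ → ℕ
cnFormula s w d = sumFromTo (w ∸ d) w (λ m → ((m ∸ 1) C (d + m ∸ w)) * ((s ∸ 1) ^ (d + m ∸ w)))

replicateσ : {s : ℕ} → ℕ → Fin s → Word s
replicateσ zero σ = []
replicateσ (suc w) σ = σ ∷ replicateσ w σ

{-# OPTIONS --safe #-}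
module Submission where

-- Write #σ U and #¬σ U for the numbers of letters of U equal to and different from σ.
-- One edit changes each count by at most one, so every U ∈ N(σ^w, d) has w ≤ d + #σ U and
-- #¬σ U ≤ d; conversely a word of length ≤ w with w ≤ d + #σ U reaches σ^w by substituting
-- its other letters and inserting σ's.  Hence a word of CN(σ^w, d) is no longer than w (else
-- its prefix of length w lies in N(σ^w, d)) and does not end with a letter other than σ (else
-- dropping that letter stays in N(σ^w, d)); this pins #σ U = w − d.  So CN(σ^w, d) consists of
-- the empty word when w = d, and otherwise of the words V σ where V has w − d − 1 letters σ
-- and i ≤ d other letters: C(w − d − 1 + i, i) (s − 1)^i of them for each i.  Summing over i
-- is the formula; for s = 2 the hockey-stick identity collapses it to C(w, d).

open import Defs
open import Data.Bool using (if_then_else_)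
open import Data.Fin using (Fin; _≟_; punchIn; punchOut)
open import Data.Fin.Properties using (punchIn-injective; punchInᵢ≢i; punchIn-punchOut)
open import Data.List
  using (List; []; _∷_; _++_; _∷ʳ_; length; map; upTo; allFin; cartesianProduct; initLast; _∷ʳ′_)
open import Data.List.Membership.Propositional using (_∈_)
open import Data.List.Membership.Propositional.Properties
  using (∈-map⁺; ∈-map⁻; ∈-++⁺ˡ; ∈-++⁺ʳ; ∈-++⁻; ∈-cartesianProduct⁺; ∈-cartesianProduct⁻; ∈-allFin)
open import Data.List.Properties
  using (length-++; length-++-≤ˡ; length-map; length-tabulate; map-++; map-cong; upTo-∷ʳ;
         ++-identityʳ; ++-conicalʳ; ∷-injective; ∷-injectiveˡ; ∷-injectiveʳ; ∷ʳ-injectiveˡ)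
open import Data.List.Relation.Unary.All using ([])
open import Data.List.Relation.Unary.AllPairs using ([]; _∷_)
open import Data.List.Relation.Unary.Any using (here; there)
open import Data.List.Relation.Unary.Unique.Propositional using (Unique)
import Data.List.Relation.Unary.Unique.Propositional.Properties as Unique
open import Data.Nat using (ℕ; zero; suc; _+_; _*_; _∸_; _^_; _≤_; _<_; z≤n; s≤s)
open import Data.Nat.Combinatorics using (_C_; nCk+nC[k+1]≡[n+1]C[k+1])
open import Data.Nat.Combinatorics.Specification using (k>n⇒nCk≡0)
open import Data.Nat.ListAction using (sum)
open import Data.Nat.ListAction.Properties using (sum-++)
open import Data.Nat.Properties
  using (≤-refl; ≤-reflexive; ≤-trans; ≤-antisym; ≤-pred; <-irrefl; n≮n; ≮⇒≥; ≰⇒>; n<1+n;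
         m<n⇒m<1+n; m<1+n⇒m<n∨m≡n; m≤n⇒m≤1+n; m≤m+n; m≤n+m; suc-injective;
         +-comm; +-assoc; +-suc; +-identityʳ; *-identityʳ; ^-zeroˡ;
         +-mono-≤; +-monoˡ-≤; +-monoʳ-≤; +-monoʳ-<;
         m≤n⇒m∸n≡0; m+n∸m≡n; m+[n∸m]≡n; m∸n+n≡m; m∸[m∸n]≡n; +-commutativeSemigroup; module ≤-Reasoning)
open import Algebra.Properties.CommutativeSemigroup +-commutativeSemigroup using (x∙yz≈y∙xz)
open import Data.Nat.Tactic.RingSolver using (solve-∀)
open import Data.Product using (Σ; ∃; _×_; _,_; proj₁; proj₂; map₂; uncurry)
import Data.Sum as Sum
open import Data.Sum using (_⊎_; inj₁; inj₂; [_,_])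
open import Data.Unit using (⊤)
open import Function using (_∘_; id)
open import Function.Bundles using (_⇔_; mk⇔; Equivalence)
open import Function.Construct.Composition using (_⇔-∘_)
open import Function.Construct.Symmetry using (⇔-sym)
open import Relation.Binary.PropositionalEquality
  using (_≡_; _≢_; refl; sym; trans; cong; cong₂; subst; module ≡-Reasoning)
open import Relation.Nullary using (¬_; contradiction; does; yes; no)
open import Relation.Nullary.Decidable using (dec-true; dec-false)
open import Relation.Unary using (_∪_)

open Equivalence using (to; from)

-- Binomial sums

weighted-pascal : ∀ t n k → (n C suc k) * t ^ suc k + t * ((n C k) * t ^ k) ≡ (suc n C suc k) * t ^ suc k
weighted-pascal t n k = begin
  (n C suc k) * t ^ suc k + t * ((n C k) * t ^ k) ≡⟨ distrib (n C suc k) (n C k) t (t ^ k) ⟩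
  (n C suc k + n C k) * t ^ suc k                 ≡⟨ cong (_* t ^ suc k) (+-comm (n C suc k) (n C k)) ⟩
  (n C k + n C suc k) * t ^ suc k                 ≡⟨ cong (_* t ^ suc k) (nCk+nC[k+1]≡[n+1]C[k+1] n k) ⟩
  (suc n C suc k) * t ^ suc k                     ∎
  where
  open ≡-Reasoning
  distrib : ∀ a b t u → a * (t * u) + t * (b * u) ≡ (a + b) * (t * u)
  distrib = solve-∀

weighted-pascal-diagonal : ∀ t n → t * ((n C n) * t ^ n) ≡ (suc n C suc n) * t ^ suc n
weighted-pascal-diagonal t n =
  trans (cong (λ c → c * t ^ suc n + t * ((n C n) * t ^ n)) (sym (k>n⇒nCk≡0 (n<1+n n))))
        (weighted-pascal t n n)

sum-upTo-suc : (c : ℕ → ℕ) (n : ℕ) → sum (map c (upTo (suc n))) ≡ sum (map c (upTo n)) + c n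
sum-upTo-suc c n = begin
  sum (map c (upTo (suc n)))            ≡⟨ cong (sum ∘ map c) (sym (upTo-∷ʳ n)) ⟩
  sum (map c (upTo n ++ n ∷ []))        ≡⟨ cong sum (map-++ c (upTo n) (n ∷ [])) ⟩
  sum (map c (upTo n) ++ c n ∷ [])      ≡⟨ sum-++ (map c (upTo n)) (c n ∷ []) ⟩
  sum (map c (upTo n)) + (c n + 0)      ≡⟨ cong (sum (map c (upTo n)) +_) (+-identityʳ (c n)) ⟩
  sum (map c (upTo n)) + c n            ∎
  where open ≡-Reasoning

-- For r = 0 the truncated r + i ∸ 1 leaves only the term i = 0.
hockey-stick : ∀ r n → sum (map (λ i → (r + i ∸ 1) C i) (upTo (suc n))) ≡ (r + n) C n
hockey-stick r zero    = refl
hockey-stick r (suc n) = begin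
  sum (map c (upTo (suc (suc n))))       ≡⟨ sum-upTo-suc c (suc n) ⟩
  sum (map c (upTo (suc n))) + c (suc n)
    ≡⟨ cong₂ _+_ (hockey-stick r n) (cong (λ m → (m ∸ 1) C suc n) (+-suc r n)) ⟩
  (r + n) C n + (r + n) C suc n          ≡⟨ nCk+nC[k+1]≡[n+1]C[k+1] (r + n) n ⟩
  suc (r + n) C suc n                    ≡⟨ cong (_C suc n) (+-suc r n) ⟨
  (r + suc n) C suc n                    ∎
  where
  open ≡-Reasoning
  c : ℕ → ℕ
  c i = (r + i ∸ 1) C i

module _ {A : Set} where

  prefix-of-length : {n : ℕ} (xs : List A) → n < length xs →
                     ∃ λ P → ∃ λ c → ∃ λ cs → xs ≡ P ++ c ∷ cs × length P ≡ n
  prefix-of-length {zero}  (x ∷ xs) _ = [] , x , xs , refl , refl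
  prefix-of-length {suc n} (x ∷ xs) (s≤s n<|xs|) =
    let P , c , cs , xs≡P++c∷cs , |P|≡n = prefix-of-length xs n<|xs|
    in x ∷ P , c , cs , cong (x ∷_) xs≡P++c∷cs , cong suc |P|≡n

  prefix-of-∷ʳ : (P V : List A) {c x : A} {cs : List A} → P ++ c ∷ cs ≡ V ∷ʳ x → ∃ λ zs → P ++ zs ≡ V
  prefix-of-∷ʳ []      V                  _  = V , refl
  prefix-of-∷ʳ (p ∷ P) []      {c} {cs = cs} eq =
    contradiction (++-conicalʳ P (c ∷ cs) (∷-injectiveʳ eq)) λ ()
  prefix-of-∷ʳ (p ∷ P) (v ∷ V) eq with refl , eq′ ← ∷-injective eq =
    let zs , P++zs≡V = prefix-of-∷ʳ P V eq′ in zs , cong (p ∷_) P++zs≡V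

  length-cartesianProduct : {B : Set} (xs : List A) (ys : List B) →
                            length (cartesianProduct xs ys) ≡ length xs * length ys
  length-cartesianProduct []       ys = refl
  length-cartesianProduct (x ∷ xs) ys = begin
    length (map (x ,_) ys ++ cartesianProduct xs ys)         ≡⟨ length-++ (map (x ,_) ys) ⟩
    length (map (x ,_) ys) + length (cartesianProduct xs ys)
      ≡⟨ cong₂ _+_ (length-map (x ,_) ys) (length-cartesianProduct xs ys) ⟩
    length ys + length xs * length ys                        ∎
    where open ≡-Reasoning

-- Finite sets given by duplicate-free enumerations

HasSize : {A : Set} → (A → Set) → ℕ → Set
HasSize {A} P n = Σ (List A) λ L → Unique L × (∀ x → (x ∈ L) ⇔ P x) × (length L ≡ n)

module _ {A : Set} where

  HasSize-resp : {P Q : A → Set} {n : ℕ} → (∀ x → P x ⇔ Q x) → HasSize P n → HasSize Q n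
  HasSize-resp P⇔Q (L , L! , L⇔P , ∣L∣) = L , L! , (λ x → P⇔Q x ⇔-∘ L⇔P x) , ∣L∣

  HasSize-∅ : {P : A → Set} → (∀ x → ¬ P x) → HasSize P 0
  HasSize-∅ ¬P = [] , [] , (λ x → mk⇔ (λ ()) (λ p → contradiction p (¬P x))) , refl

  HasSize-singleton : (a : A) → HasSize (_≡ a) 1
  HasSize-singleton a = a ∷ [] , [] ∷ [] , (λ x → mk⇔ (λ { (here x≡a) → x≡a ; (there ()) }) here) , refl

  HasSize-∪ : {P Q : A → Set} {m n : ℕ} → (∀ x → P x → ¬ Q x) →
              HasSize P m → HasSize Q n → HasSize (P ∪ Q) (m + n)
  HasSize-∪ P∩Q=∅ (L , L! , L⇔P , ∣L∣) (K , K! , K⇔Q , ∣K∣) =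
    L ++ K ,
    Unique.++⁺ L! K! (λ {x} (x∈L , x∈K) → P∩Q=∅ x (to (L⇔P x) x∈L) (to (K⇔Q x) x∈K)) ,
    (λ x → mk⇔ ([ inj₁ ∘ to (L⇔P x) , inj₂ ∘ to (K⇔Q x) ] ∘ ∈-++⁻ L)
               [ ∈-++⁺ˡ ∘ from (L⇔P x) , ∈-++⁺ʳ L ∘ from (K⇔Q x) ]) ,
    trans (length-++ L) (cong₂ _+_ ∣L∣ ∣K∣)

  HasSize-fibres : {P : A → Set} (f : A → ℕ) (c : ℕ → ℕ) →
                   (∀ i → HasSize (λ x → P x × f x ≡ i) (c i)) →
                   ∀ n → HasSize (λ x → P x × f x < n) (sum (map c (upTo n)))
  HasSize-fibres f c fibre zero    = HasSize-∅ (λ _ ())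
  HasSize-fibres {P} f c fibre (suc n) =
    subst (HasSize _) (sym (sum-upTo-suc c n))
      (HasSize-resp split (HasSize-∪ disjoint (HasSize-fibres f c fibre n) (fibre n)))
    where
    disjoint : ∀ x → P x × f x < n → ¬ (P x × f x ≡ n)
    disjoint x (_ , fx<n) (_ , fx≡n) = <-irrefl fx≡n fx<n
    split : ∀ x → ((P x × f x < n) ⊎ (P x × f x ≡ n)) ⇔ (P x × f x < suc n)
    split x = mk⇔ [ map₂ m<n⇒m<1+n , map₂ (s≤s ∘ ≤-reflexive) ]
                  (λ (Px , fx<1+n) → Sum.map (Px ,_) (Px ,_) (m<1+n⇒m<n∨m≡n fx<1+n))

module _ {A B : Set} where

  HasSize-image : {P : A → Set} {n : ℕ} (f : A → B) → (∀ {x y} → f x ≡ f y → x ≡ y) →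
                  HasSize P n → HasSize (λ y → ∃ λ x → P x × y ≡ f x) n
  HasSize-image f f-inj (L , L! , L⇔P , ∣L∣) =
    map f L ,
    Unique.map⁺ f-inj L! ,
    (λ y → mk⇔ (λ y∈fL → let x , x∈L , y≡fx = ∈-map⁻ f y∈fL in x , to (L⇔P x) x∈L , y≡fx)
               (λ { (x , Px , refl) → ∈-map⁺ f (from (L⇔P x) Px) })) ,
    trans (length-map f L) ∣L∣

  HasSize-× : {P : A → Set} {Q : B → Set} {m n : ℕ} → HasSize P m → HasSize Q n →
              HasSize (λ ab → P (proj₁ ab) × Q (proj₂ ab)) (m * n)
  HasSize-× (L , L! , L⇔P , ∣L∣) (K , K! , K⇔Q , ∣K∣) =
    cartesianProduct L K ,
    Unique.cartesianProduct⁺ L! K! ,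
    (λ { (a , b) → mk⇔ (λ ab∈L×K → let a∈L , b∈K = ∈-cartesianProduct⁻ L K ab∈L×K
                                    in to (L⇔P a) a∈L , to (K⇔Q b) b∈K)
                        (λ (Pa , Qb) → ∈-cartesianProduct⁺ (from (L⇔P a) Pa) (from (K⇔Q b) Qb)) }) ,
    trans (length-cartesianProduct L K) (cong₂ _*_ ∣L∣ ∣K∣)

HasSize-Fin : (n : ℕ) → HasSize {Fin n} (λ _ → ⊤) n
HasSize-Fin n = allFin n , Unique.allFin⁺ n , (λ i → mk⇔ _ (λ _ → ∈-allFin i)) , length-tabulate id

HasSize-≢ : {n : ℕ} (i : Fin n) → HasSize (_≢ i) (n ∸ 1)
HasSize-≢ {suc n} i =
  HasSize-resp image⇔≢ (HasSize-image (punchIn i) (punchIn-injective i _ _) (HasSize-Fin n))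
  where
  image⇔≢ : ∀ j → (∃ λ k → ⊤ × j ≡ punchIn i k) ⇔ j ≢ i
  image⇔≢ j = mk⇔ (λ { (k , _ , refl) → punchInᵢ≢i i k })
                  (λ j≢i → punchOut (j≢i ∘ sym) , _ , sym (punchIn-punchOut (j≢i ∘ sym)))

-- Letter counts under edits

weight : {A : Set} → (A → ℕ) → List A → ℕ
weight g = sum ∘ map g

module _ {A : Set} (g : A → ℕ) where

  weight-++ : (xs ys : List A) → weight g (xs ++ ys) ≡ weight g xs + weight g ys
  weight-++ xs ys = trans (cong sum (map-++ g xs ys)) (sum-++ (map g xs) (map g ys))

  weight-insert : (xs ys : List A) (a : A) → weight g (xs ++ a ∷ ys) ≡ g a + weight g (xs ++ ys)
  weight-insert []       ys a = refl
  weight-insert (x ∷ xs) ys a = begin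
    g x + weight g (xs ++ a ∷ ys)     ≡⟨ cong (g x +_) (weight-insert xs ys a) ⟩
    g x + (g a + weight g (xs ++ ys)) ≡⟨ x∙yz≈y∙xz (g x) (g a) _ ⟩
    g a + (g x + weight g (xs ++ ys)) ∎
    where open ≡-Reasoning

  weight-∷ʳ : (xs : List A) (a : A) → weight g (xs ∷ʳ a) ≡ weight g (a ∷ xs)
  weight-∷ʳ xs a = trans (weight-insert xs [] a) (cong (λ ys → g a + weight g ys) (++-identityʳ xs))

  weight-prefix : (xs ys : List A) → weight g xs ≤ weight g (xs ++ ys)
  weight-prefix xs ys = subst (weight g xs ≤_) (sym (weight-++ xs ys)) (m≤m+n _ _)

module _ {s : ℕ} where

  OneEdit-sym : {U V : Word s} → OneEdit U V → OneEdit V U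
  OneEdit-sym (ins xs ys a)   = del xs ys a
  OneEdit-sym (del xs ys a)   = ins xs ys a
  OneEdit-sym (sub xs ys a b) = sub xs ys b a

  OneEdit-∷ : {U V : Word s} (x : Fin s) → OneEdit U V → OneEdit (x ∷ U) (x ∷ V)
  OneEdit-∷ x (ins xs ys a)   = ins (x ∷ xs) ys a
  OneEdit-∷ x (del xs ys a)   = del (x ∷ xs) ys a
  OneEdit-∷ x (sub xs ys a b) = sub (x ∷ xs) ys a b

  Within-∷ : {k : ℕ} {U V : Word s} (x : Fin s) → Within k U V → Within k (x ∷ U) (x ∷ V)
  Within-∷ x done       = done
  Within-∷ x (step e r) = step (OneEdit-∷ x e) (Within-∷ x r)

  Within-weaken : {k l : ℕ} {U V : Word s} → k ≤ l → Within k U V → Within l U V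
  Within-weaken _         done       = done
  Within-weaken (s≤s k≤l) (step e r) = step e (Within-weaken k≤l r)

  module _ {g : Fin s → ℕ} (g≤1 : ∀ x → g x ≤ 1) where

    weight-OneEdit : {U V : Word s} → OneEdit U V → weight g U ≤ suc (weight g V)
    weight-OneEdit (ins xs ys a) rewrite weight-insert g xs ys a =
      m≤n⇒m≤1+n (m≤n+m _ (g a))
    weight-OneEdit (del xs ys a) rewrite weight-insert g xs ys a =
      +-monoˡ-≤ _ (g≤1 a)
    weight-OneEdit (sub xs ys a b) rewrite weight-insert g xs ys a | weight-insert g xs ys b =
      +-mono-≤ (g≤1 a) (m≤n+m _ (g b))

    Within-weightˡ : {k : ℕ} {U V : Word s} → Within k U V → weight g U ≤ k + weight g V
    Within-weightˡ {k} done   = m≤n+m _ k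
    Within-weightˡ (step e r) = ≤-trans (weight-OneEdit e) (s≤s (Within-weightˡ r))

    Within-weightʳ : {k : ℕ} {U V : Word s} → Within k U V → weight g V ≤ k + weight g U
    Within-weightʳ {k} done = m≤n+m _ k
    Within-weightʳ {suc k} {U} {W} (step {V = V} e r) = begin
      weight g W           ≤⟨ Within-weightʳ r ⟩
      k + weight g V       ≤⟨ +-monoʳ-≤ k (weight-OneEdit (OneEdit-sym e)) ⟩
      k + suc (weight g U) ≡⟨ +-suc k _ ⟩
      suc (k + weight g U) ∎
      where open ≤-Reasoning

-- The condensed neighbourhood of σ^w

-- The term of cnFormula at m = w − d + i, with r = w − d; truncated subtraction lets the
-- case r = 0, where only the empty word is counted, share the formula.
cnTerm : ℕ → ℕ → ℕ → ℕ
cnTerm s r i = ((r + i ∸ 1) C i) * (s ∸ 1) ^ i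

module _ {s : ℕ} (σ : Fin s) where

  [≡σ] [≢σ] : Fin s → ℕ
  [≡σ] x = if does (x ≟ σ) then 1 else 0
  [≢σ] x = if does (x ≟ σ) then 0 else 1

  #σ #¬σ : Word s → ℕ
  #σ  = weight [≡σ]
  #¬σ = weight [≢σ]

  [≡σ]≤1 : ∀ x → [≡σ] x ≤ 1
  [≡σ]≤1 x with x ≟ σ
  ... | yes _ = ≤-refl
  ... | no _  = z≤n

  [≢σ]≤1 : ∀ x → [≢σ] x ≤ 1
  [≢σ]≤1 x with x ≟ σ
  ... | yes _ = z≤n
  ... | no _  = ≤-refl

  [≡σ]-σ : [≡σ] σ ≡ 1
  [≡σ]-σ rewrite dec-true (σ ≟ σ) refl = refl

  [≢σ]-σ : [≢σ] σ ≡ 0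
  [≢σ]-σ rewrite dec-true (σ ≟ σ) refl = refl

  [≡σ]-≢ : ∀ {x} → x ≢ σ → [≡σ] x ≡ 0
  [≡σ]-≢ {x} x≢σ rewrite dec-false (x ≟ σ) x≢σ = refl

  [≢σ]-≢ : ∀ {x} → x ≢ σ → [≢σ] x ≡ 1
  [≢σ]-≢ {x} x≢σ rewrite dec-false (x ≟ σ) x≢σ = refl

  length≡#σ+#¬σ : (U : Word s) → length U ≡ #σ U + #¬σ U
  length≡#σ+#¬σ []      = refl
  length≡#σ+#¬σ (x ∷ U) with x ≟ σ
  ... | yes _ = cong suc (length≡#σ+#¬σ U)
  ... | no _  = trans (cong suc (length≡#σ+#¬σ U)) (sym (+-suc (#σ U) (#¬σ U)))

  #σ≤length : (U : Word s) → #σ U ≤ length U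
  #σ≤length U = subst (#σ U ≤_) (sym (length≡#σ+#¬σ U)) (m≤m+n (#σ U) (#¬σ U))

  #σ-∷ʳσ : (V : Word s) → #σ (V ∷ʳ σ) ≡ suc (#σ V)
  #σ-∷ʳσ V = trans (weight-∷ʳ [≡σ] V σ) (cong (_+ #σ V) [≡σ]-σ)

  #¬σ-∷ʳσ : (V : Word s) → #¬σ (V ∷ʳ σ) ≡ #¬σ V
  #¬σ-∷ʳσ V = trans (weight-∷ʳ [≢σ] V σ) (cong (_+ #¬σ V) [≢σ]-σ)

  #σ-replicate : ∀ w → #σ (replicateσ w σ) ≡ w
  #σ-replicate zero    = refl
  #σ-replicate (suc w) = cong₂ _+_ [≡σ]-σ (#σ-replicate w)

  #¬σ-replicate : ∀ w → #¬σ (replicateσ w σ) ≡ 0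
  #¬σ-replicate zero    = refl
  #¬σ-replicate (suc w) = cong₂ _+_ [≢σ]-σ (#¬σ-replicate w)

  Within-replicate⇒w≤k+#σ : ∀ {k w} {U : Word s} → Within k U (replicateσ w σ) → w ≤ k + #σ U
  Within-replicate⇒w≤k+#σ {k} {w} {U} r =
    subst (_≤ k + #σ U) (#σ-replicate w) (Within-weightʳ [≡σ]≤1 r)

  Within-replicate⇒#¬σ≤k : ∀ {k w} {U : Word s} → Within k U (replicateσ w σ) → #¬σ U ≤ k
  Within-replicate⇒#¬σ≤k {k} {w} {U} r =
    subst (#¬σ U ≤_) (trans (cong (k +_) (#¬σ-replicate w)) (+-identityʳ k)) (Within-weightˡ [≢σ]≤1 r)

  Within-[]-replicate : ∀ w → Within w [] (replicateσ w σ)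
  Within-[]-replicate zero    = done
  Within-[]-replicate (suc w) = step (ins [] [] σ) (Within-∷ σ (Within-[]-replicate w))

  Within-replicate : ∀ {k w} (U : Word s) → length U ≤ w → w ≤ k + #σ U → Within k U (replicateσ w σ)
  Within-replicate {k} {w} [] _ w≤k+0 =
    Within-weaken (subst (w ≤_) (+-identityʳ k) w≤k+0) (Within-[]-replicate w)
  Within-replicate {k} {suc w} (x ∷ U) (s≤s |U|≤w) w<k+#σ with x ≟ σ
  ... | yes refl = Within-∷ σ (Within-replicate U |U|≤w (≤-pred (subst (suc w ≤_) (+-suc k (#σ U)) w<k+#σ)))
  ... | no _     = substitute k w<k+#σ
    where
    substitute : ∀ l → suc w ≤ l + #σ U → Within l (x ∷ U) (σ ∷ replicateσ w σ)
    substitute zero    w<#σ   = contradiction (≤-trans w<#σ (≤-trans (#σ≤length U) |U|≤w)) (n≮n w)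
    substitute (suc l) w<l+#σ = step (sub [] U x σ) (Within-∷ σ (Within-replicate U |U|≤w (≤-pred w<l+#σ)))

  EmptyOrEndsWithσ : Word s → Set
  EmptyOrEndsWithσ U = U ≡ [] ⊎ ∃ λ V → U ≡ V ∷ʳ σ

  proper-prefix-#σ< : ∀ {U P : Word s} {c cs} → EmptyOrEndsWithσ U → U ≡ P ++ c ∷ cs → #σ P < #σ U
  proper-prefix-#σ< {P = P} {c} {cs} (inj₁ refl) []≡P++c∷cs =
    contradiction (++-conicalʳ P (c ∷ cs) (sym []≡P++c∷cs)) λ ()
  proper-prefix-#σ< {P = P} (inj₂ (V , refl)) V∷ʳσ≡P++c∷cs =
    let zs , P++zs≡V = prefix-of-∷ʳ P V (sym V∷ʳσ≡P++c∷cs) in begin-strict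
      #σ P         ≤⟨ weight-prefix [≡σ] P zs ⟩
      #σ (P ++ zs) ≡⟨ cong #σ P++zs≡V ⟩
      #σ V         <⟨ n<1+n (#σ V) ⟩
      suc (#σ V)   ≡⟨ #σ-∷ʳσ V ⟨
      #σ (V ∷ʳ σ)  ∎
    where open ≤-Reasoning

  module _ {w d : ℕ} (d≤w : d ≤ w) where

    ends-with-σ⇒InCN : ∀ {U} → (#σ U ≡ w ∸ d × EmptyOrEndsWithσ U) × #¬σ U ≤ d → InCN (replicateσ w σ) d U
    ends-with-σ⇒InCN {U} ((#σU≡w∸d , ends) , #¬σU≤d) =
      Within-replicate U |U|≤w (≤-reflexive w≡d+#σU) , no-prefix
      where
      w≡d+#σU : w ≡ d + #σ U
      w≡d+#σU = trans (sym (m+[n∸m]≡n d≤w)) (cong (d +_) (sym #σU≡w∸d))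
      |U|≤w : length U ≤ w
      |U|≤w = begin
        length U     ≡⟨ length≡#σ+#¬σ U ⟩
        #σ U + #¬σ U ≤⟨ +-monoʳ-≤ (#σ U) #¬σU≤d ⟩
        #σ U + d     ≡⟨ +-comm (#σ U) d ⟩
        d + #σ U     ≡⟨ w≡d+#σU ⟨
        w            ∎
        where open ≤-Reasoning
      no-prefix : ¬ InNΣ⁺ (replicateσ w σ) d U
      no-prefix (P , c , cs , U≡P++c∷cs , P∈N) = n≮n w (begin-strict
        w        ≤⟨ Within-replicate⇒w≤k+#σ P∈N ⟩
        d + #σ P <⟨ +-monoʳ-< d (proper-prefix-#σ< ends U≡P++c∷cs) ⟩
        d + #σ U ≡⟨ w≡d+#σU ⟨
        w        ∎)
        where open ≤-Reasoning

    InCN⇒length≤ : ∀ {U} → InCN (replicateσ w σ) d U → length U ≤ w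
    InCN⇒length≤ {U} (U∈N , no-prefix) = ≮⇒≥ λ w<|U| →
      let P , c , cs , U≡P++c∷cs , |P|≡w = prefix-of-length U w<|U|
      in no-prefix (P , c , cs , U≡P++c∷cs ,
                    Within-replicate P (≤-reflexive |P|≡w) (w≤d+#σ U≡P++c∷cs |P|≡w))
      where
      w≤d+#σ : ∀ {P c cs} → U ≡ P ++ c ∷ cs → length P ≡ w → w ≤ d + #σ P
      w≤d+#σ {P} {c} {cs} U≡P++c∷cs |P|≡w = begin
        w                        ≡⟨ |P|≡w ⟨
        length P                 ≡⟨ length≡#σ+#¬σ P ⟩
        #σ P + #¬σ P             ≤⟨ +-monoʳ-≤ (#σ P) (weight-prefix [≢σ] P (c ∷ cs)) ⟩
        #σ P + #¬σ (P ++ c ∷ cs) ≡⟨ cong (λ V → #σ P + #¬σ V) U≡P++c∷cs ⟨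
        #σ P + #¬σ U             ≤⟨ +-monoʳ-≤ (#σ P) (Within-replicate⇒#¬σ≤k U∈N) ⟩
        #σ P + d                 ≡⟨ +-comm (#σ P) d ⟩
        d + #σ P                 ∎
        where open ≤-Reasoning

    InCN-∷ʳ⇒d+#σ<w : ∀ {V x} → InCN (replicateσ w σ) d (V ∷ʳ x) → d + #σ V < w
    InCN-∷ʳ⇒d+#σ<w {V} {x} V∷ʳx∈CN@(_ , no-prefix) = ≰⇒> λ w≤d+#σV →
      no-prefix (V , x , [] , refl ,
                 Within-replicate V (≤-trans (length-++-≤ˡ V) (InCN⇒length≤ V∷ʳx∈CN)) w≤d+#σV)

    InCN⇒ends-with-σ : ∀ {U} → InCN (replicateσ w σ) d U → #σ U ≡ w ∸ d × EmptyOrEndsWithσ U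
    InCN⇒ends-with-σ {U} U∈CN@(U∈N , _) with initLast U
    ... | [] = sym (m≤n⇒m∸n≡0 (subst (w ≤_) (+-identityʳ d) (Within-replicate⇒w≤k+#σ U∈N))) , inj₁ refl
    ... | V ∷ʳ′ x with x ≟ σ
    ...   | yes refl = trans (sym (m+n∸m≡n d _)) (cong (_∸ d) d+#σU≡w) , inj₂ (V , refl)
      where
      d+#σU≡w : d + #σ (V ∷ʳ σ) ≡ w
      d+#σU≡w = ≤-antisym (begin
        d + #σ (V ∷ʳ σ) ≡⟨ cong (d +_) (#σ-∷ʳσ V) ⟩
        d + suc (#σ V)  ≡⟨ +-suc d (#σ V) ⟩
        suc (d + #σ V)  ≤⟨ InCN-∷ʳ⇒d+#σ<w U∈CN ⟩
        w               ∎) (Within-replicate⇒w≤k+#σ U∈N)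
        where open ≤-Reasoning
    ...   | no x≢σ = contradiction w<w (n≮n w)
      where
      w<w : w < w
      w<w = begin-strict
        w               ≤⟨ Within-replicate⇒w≤k+#σ U∈N ⟩
        d + #σ (V ∷ʳ x) ≡⟨ cong (d +_) (trans (weight-∷ʳ [≡σ] V x) (cong (_+ #σ V) ([≡σ]-≢ x≢σ))) ⟩
        d + #σ V        <⟨ InCN-∷ʳ⇒d+#σ<w U∈CN ⟩
        w               ∎
        where open ≤-Reasoning

    InCN-replicate⇔ : ∀ U → InCN (replicateσ w σ) d U ⇔ ((#σ U ≡ w ∸ d × EmptyOrEndsWithσ U) × #¬σ U ≤ d)
    InCN-replicate⇔ U =
      mk⇔ (λ U∈CN → InCN⇒ends-with-σ U∈CN , Within-replicate⇒#¬σ≤k (proj₁ U∈CN)) ends-with-σ⇒InCN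

  Profile : ℕ → ℕ → Word s → Set
  Profile p q U = #σ U ≡ p × #¬σ U ≡ q

  data ProfileView : ℕ → ℕ → Word s → Set where
    []  : ProfileView 0 0 []
    σ∷  : ∀ {p q} V → Profile p q V → ProfileView (suc p) q (σ ∷ V)
    ≢σ∷ : ∀ {p q x} → x ≢ σ → ∀ V → Profile p q V → ProfileView p (suc q) (x ∷ V)

  profile-view : ∀ {p q} U → Profile p q U → ProfileView p q U
  profile-view []      (refl , refl) = []
  profile-view (x ∷ V) (refl , refl) with x ≟ σ
  ... | yes refl = σ∷ V (refl , refl)
  ... | no x≢σ  = ≢σ∷ x≢σ V (refl , refl)

  view-profile : ∀ {p q U} → ProfileView p q U → Profile p q U
  view-profile []                  = refl , refl
  view-profile (σ∷ _ (a , b))      = cong₂ _+_ [≡σ]-σ a , cong₂ _+_ [≢σ]-σ b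
  view-profile (≢σ∷ x≢σ _ (a , b)) = cong₂ _+_ ([≡σ]-≢ x≢σ) a , cong₂ _+_ ([≢σ]-≢ x≢σ) b

  σ∷Profile : ℕ → ℕ → Word s → Set
  σ∷Profile p q U = ∃ λ V → Profile p q V × U ≡ σ ∷ V

  ≢σ∷Profile : ℕ → ℕ → Word s → Set
  ≢σ∷Profile p q U =
    ∃ λ (xV : Fin s × Word s) → (proj₁ xV ≢ σ × Profile p q (proj₂ xV)) × U ≡ proj₁ xV ∷ proj₂ xV

  σ∷Profile-size : ∀ {p q n} → HasSize (Profile p q) n → HasSize (σ∷Profile p q) n
  σ∷Profile-size = HasSize-image (σ ∷_) ∷-injectiveʳ

  ≢σ∷Profile-size : ∀ {p q n} → HasSize (Profile p q) n → HasSize (≢σ∷Profile p q) ((s ∸ 1) * n)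
  ≢σ∷Profile-size = HasSize-image (uncurry _∷_) uncurry-∷-injective ∘ HasSize-× (HasSize-≢ σ)
    where
    uncurry-∷-injective : ∀ {xV yW : Fin s × Word s} → uncurry _∷_ xV ≡ uncurry _∷_ yW → xV ≡ yW
    uncurry-∷-injective eq = uncurry (cong₂ _,_) (∷-injective eq)

  σ∷Profile⇒Profile : ∀ {p q U} → σ∷Profile p q U → Profile (suc p) q U
  σ∷Profile⇒Profile (V , h , refl) = view-profile (σ∷ V h)

  ≢σ∷Profile⇒Profile : ∀ {p q U} → ≢σ∷Profile p q U → Profile p (suc q) U
  ≢σ∷Profile⇒Profile ((_ , V) , (x≢σ , h) , refl) = view-profile (≢σ∷ x≢σ V h)

  Profile-size : ∀ p q → HasSize (Profile p q) (((p + q) C q) * (s ∸ 1) ^ q)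
  Profile-size zero zero =
    HasSize-resp (λ U → mk⇔ (λ { refl → refl , refl }) (only-[] U)) (HasSize-singleton [])
    where
    only-[] : ∀ U → Profile 0 0 U → U ≡ []
    only-[] U h with profile-view U h
    ... | [] = refl
  Profile-size (suc p) zero =
    HasSize-resp (λ U → mk⇔ σ∷Profile⇒Profile (σ-first U)) (σ∷Profile-size (Profile-size p zero))
    where
    σ-first : ∀ U → Profile (suc p) zero U → σ∷Profile p zero U
    σ-first U h with profile-view U h
    ... | σ∷ V h′ = V , h′ , refl
  Profile-size zero (suc q) =
    subst (HasSize _) (weighted-pascal-diagonal (s ∸ 1) q)
      (HasSize-resp (λ U → mk⇔ ≢σ∷Profile⇒Profile (other-first U)) (≢σ∷Profile-size (Profile-size zero q)))
    where
    other-first : ∀ U → Profile zero (suc q) U → ≢σ∷Profile zero q U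
    other-first U h with profile-view U h
    ... | ≢σ∷ x≢σ V h′ = (_ , V) , (x≢σ , h′) , refl
  Profile-size (suc p) (suc q) =
    subst (HasSize _) pascal
      (HasSize-resp (λ U → mk⇔ [ σ∷Profile⇒Profile , ≢σ∷Profile⇒Profile ] (first-letter U))
        (HasSize-∪ disjoint (σ∷Profile-size (Profile-size p (suc q)))
                            (≢σ∷Profile-size (Profile-size (suc p) q))))
    where
    first-letter : ∀ U → Profile (suc p) (suc q) U → σ∷Profile p (suc q) U ⊎ ≢σ∷Profile (suc p) q U
    first-letter U h with profile-view U h
    ... | σ∷ V h′       = inj₁ (V , h′ , refl)
    ... | ≢σ∷ x≢σ V h′ = inj₂ ((_ , V) , (x≢σ , h′) , refl)
    disjoint : ∀ U → σ∷Profile p (suc q) U → ¬ ≢σ∷Profile (suc p) q U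
    disjoint _ (_ , _ , refl) (_ , (x≢σ , _) , eq) = x≢σ (sym (∷-injectiveˡ eq))
    pascal : ((p + suc q) C suc q) * (s ∸ 1) ^ suc q + (s ∸ 1) * (((suc p + q) C q) * (s ∸ 1) ^ q)
           ≡ ((suc p + suc q) C suc q) * (s ∸ 1) ^ suc q
    pascal rewrite sym (+-suc p q) = weighted-pascal (s ∸ 1) (p + suc q) q

  ends-with-σ-fibre-size : ∀ r i → HasSize (λ U → (#σ U ≡ r × EmptyOrEndsWithσ U) × #¬σ U ≡ i) (cnTerm s r i)
  ends-with-σ-fibre-size zero zero =
    HasSize-resp (λ U → mk⇔ (λ { refl → (refl , inj₁ refl) , refl }) only-[]) (HasSize-singleton [])
    where
    only-[] : ∀ {U} → (#σ U ≡ 0 × EmptyOrEndsWithσ U) × #¬σ U ≡ 0 → U ≡ []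
    only-[] ((_ , inj₁ U≡[]) , _)           = U≡[]
    only-[] ((#σ≡0 , inj₂ (V , refl)) , _) = contradiction (trans (sym (#σ-∷ʳσ V)) #σ≡0) λ ()
  ends-with-σ-fibre-size zero (suc i) =
    subst (HasSize _) (sym (cong (_* (s ∸ 1) ^ suc i) (k>n⇒nCk≡0 (n<1+n i)))) (HasSize-∅ none)
    where
    none : ∀ U → ¬ ((#σ U ≡ 0 × EmptyOrEndsWithσ U) × #¬σ U ≡ suc i)
    none _ ((_ , inj₁ refl) , ())
    none _ ((#σ≡0 , inj₂ (V , refl)) , _) = contradiction (trans (sym (#σ-∷ʳσ V)) #σ≡0) λ ()
  ends-with-σ-fibre-size (suc r) i =
    HasSize-resp (λ U → mk⇔ append-σ (remove-σ U))
      (HasSize-image (_∷ʳ σ) (λ {V} {W} → ∷ʳ-injectiveˡ V W) (Profile-size r i))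
    where
    append-σ : ∀ {U} → (∃ λ V → Profile r i V × U ≡ V ∷ʳ σ) →
               (#σ U ≡ suc r × EmptyOrEndsWithσ U) × #¬σ U ≡ i
    append-σ (V , (#σV≡r , #¬σV≡i) , refl) =
      (trans (#σ-∷ʳσ V) (cong suc #σV≡r) , inj₂ (V , refl)) , trans (#¬σ-∷ʳσ V) #¬σV≡i
    remove-σ : ∀ U → (#σ U ≡ suc r × EmptyOrEndsWithσ U) × #¬σ U ≡ i →
               ∃ λ V → Profile r i V × U ≡ V ∷ʳ σ
    remove-σ _ ((() , inj₁ refl) , _)
    remove-σ _ ((#σ≡1+r , inj₂ (V , refl)) , #¬σ≡i) =
      V , (suc-injective (trans (sym (#σ-∷ʳσ V)) #σ≡1+r) , trans (sym (#¬σ-∷ʳσ V)) #¬σ≡i) , refl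

  InCN-replicate-size : ∀ {w d} → d ≤ w →
    HasSize (InCN (replicateσ w σ) d) (sum (map (cnTerm s (w ∸ d)) (upTo (suc d))))
  InCN-replicate-size {w} {d} d≤w =
    HasSize-resp (λ U → ⇔-sym (InCN-replicate⇔ d≤w U) ⇔-∘ <1+n⇔≤)
      (HasSize-fibres #¬σ _ (ends-with-σ-fibre-size (w ∸ d)) (suc d))
    where
    <1+n⇔≤ : ∀ {A : Set} {m} → (A × m < suc d) ⇔ (A × m ≤ d)
    <1+n⇔≤ = mk⇔ (map₂ ≤-pred) (map₂ s≤s)

cnFormula-reindexed : ∀ s {w d} → d ≤ w → cnFormula s w d ≡ sum (map (cnTerm s (w ∸ d)) (upTo (suc d)))
cnFormula-reindexed s {w} {d} d≤w =
  trans (cong (λ n → sum (map term (upTo (suc n)))) (m∸[m∸n]≡n d≤w))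
        (cong sum (map-cong (λ i → cong (λ k → ((w ∸ d + i ∸ 1) C k) * (s ∸ 1) ^ k) (exponent≡ i))
                            (upTo (suc d))))
  where
  term : ℕ → ℕ
  term i = ((w ∸ d + i ∸ 1) C (d + (w ∸ d + i) ∸ w)) * ((s ∸ 1) ^ (d + (w ∸ d + i) ∸ w))
  exponent≡ : ∀ i → d + (w ∸ d + i) ∸ w ≡ i
  exponent≡ i = trans (cong (_∸ w) (trans (sym (+-assoc d (w ∸ d) i)) (cong (_+ i) (m+[n∸m]≡n d≤w))))
                      (m+n∸m≡n w i)

cnFormula-binary : ∀ {w d} → d ≤ w → cnFormula 2 w d ≡ w C d
cnFormula-binary {w} {d} d≤w = begin
  cnFormula 2 w d                                      ≡⟨ cnFormula-reindexed 2 d≤w ⟩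
  sum (map (cnTerm 2 (w ∸ d)) (upTo (suc d)))          ≡⟨ cong sum (map-cong drop-power (upTo (suc d))) ⟩
  sum (map (λ i → (w ∸ d + i ∸ 1) C i) (upTo (suc d))) ≡⟨ hockey-stick (w ∸ d) d ⟩
  (w ∸ d + d) C d                                      ≡⟨ cong (_C d) (m∸n+n≡m d≤w) ⟩
  w C d                                                ∎
  where
  open ≡-Reasoning
  drop-power : ∀ i → cnTerm 2 (w ∸ d) i ≡ (w ∸ d + i ∸ 1) C i
  drop-power i = trans (cong (((w ∸ d + i ∸ 1) C i) *_) (^-zeroˡ i)) (*-identityʳ _)

proposition1 : (s : ℕ) (σ : Fin s) (w d : ℕ) → 0 < d → d ≤ w →
    HasCard (InCN (replicateσ w σ) d) (cnFormula s w d)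
    × (s ≡ 2 → HasCard (InCN (replicateσ w σ) d) (w C d))
proposition1 s σ w d _ d≤w = size , λ { refl → subst (HasCard _) (cnFormula-binary d≤w) size }
  where
  size : HasCard (InCN (replicateσ w σ) d) (cnFormula s w d)
  size = subst (HasSize _) (sym (cnFormula-reindexed s d≤w)) (InCN-replicate-size σ d≤w)
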